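{- Let $G$ be a connected stepwise irregular graph. Then the subdivision graph $S(G)$ is not stepwise irregular.
   Context: All graphs are finite and simple. A graph $G$ is stepwise irregular (SI) if for every edge $uv\in E(G)$ one has $|d_G(u)-d_G(v)|=1$, where $d_G$ denotes degree. The subdivision graph $S(G)$ is obtained from $G$ by inserting one new vertex into each edge of $G$ (i.e. replacing each edge $uv$ by a path $u w v$ with a new vertex $w$). -}

module Defs where

open import Data.Nat using (ℕ; _<_)
open import Data.Fin using (Fin; toℕ)
open import Data.Fin.Properties using (_<?_)
open import Data.List using (List; []; _∷_; _++_; map; concatMap; filter; length; allFin)
open import Data.Product using (Σ; Σ-syntax; _×_; _,_; ∃-syntax)
open import Data.Sum using (_⊎_; inj₁; inj₂)
open import Data.Empty using (⊥)
open import Relation.Nullary using (¬_; Dec; yes; no)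
open import Relation.Nullary.Decidable using (_×-dec_; _⊎-dec_)
open import Relation.Binary using (Decidable; Symmetric; Irreflexive)
open import Relation.Binary.PropositionalEquality using (_≡_)
import Data.Fin as F

record SimpleGraph (n : ℕ) : Set₁ where
  field
    Adj  : Fin n → Fin n → Set
    adj? : Decidable Adj
    sym  : Symmetric Adj
    irr  : Irreflexive _≡_ Adj

-- A finite graph presented by a duplicate-free list of all its vertices
-- and a decidable adjacency relation (used uniformly for G and S(G)).
record FinGraph : Set₁ where
  field
    V     : Set
    verts : List V
    Adj   : V → V → Set
    adj?  : Decidable Adj

  degree : V → ℕ
  degree v = length (filter (adj? v) verts)

open import Data.Nat using (_∸_; _+_)
dist : ℕ → ℕ → ℕ
dist a b = (a ∸ b) + (b ∸ a)

StepwiseIrregular : FinGraph → Set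
StepwiseIrregular H = ∀ u v → Adj u v → dist (degree u) (degree v) ≡ 1
  where open FinGraph H

module _ {n : ℕ} (G : SimpleGraph n) where
  open SimpleGraph G

  toFinGraph : FinGraph
  toFinGraph = record { V = Fin n ; verts = allFin n ; Adj = Adj ; adj? = adj? }

  data Reach : Fin n → Fin n → Set where
    here : ∀ {u} → Reach u u
    step : ∀ {u v w} → Adj u v → Reach v w → Reach u w

  Connected : Set
  Connected = ∀ u v → Reach u v

  -- edges of G, each unordered edge {i,j} represented once as (i , j) with i < j
  Edge : Set
  Edge = Σ[ i ∈ Fin n ] Σ[ j ∈ Fin n ] (i F.< j × Adj i j)

  edgeList : List Edge
  edgeList = concatMap (λ i → concatMap (λ j → pick i j) (allFin n)) (allFin n)
    where
    pick : (i j : Fin n) → List Edge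
    pick i j with (i <? j) ×-dec adj? i j
    ... | yes p = (i , j , p) ∷ []
    ... | no _  = []

  -- adjacency in S(G): original vertex v is adjacent to the new vertex of edge ij iff v ∈ {i,j}
  Inc : Fin n → Edge → Set
  Inc v (i , j , _) = v ≡ i ⊎ v ≡ j

  inc? : (v : Fin n) (e : Edge) → Dec (Inc v e)
  inc? v (i , j , _) = (v F.≟ i) ⊎-dec (v F.≟ j)

  SAdj : Fin n ⊎ Edge → Fin n ⊎ Edge → Set
  SAdj (inj₁ v) (inj₂ e) = Inc v e
  SAdj (inj₂ e) (inj₁ v) = Inc v e
  SAdj (inj₁ _) (inj₁ _) = ⊥
  SAdj (inj₂ _) (inj₂ _) = ⊥

  sadj? : Decidable SAdj
  sadj? (inj₁ v) (inj₂ e) = inc? v e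
  sadj? (inj₂ e) (inj₁ v) = inc? v e
  sadj? (inj₁ _) (inj₁ _) = no (λ ())
  sadj? (inj₂ _) (inj₂ _) = no (λ ())

  subdivision : FinGraph
  subdivision = record
    { V = Fin n ⊎ Edge
    ; verts = map inj₁ (allFin n) ++ map inj₂ edgeList
    ; Adj = SAdj
    ; adj? = sadj? }

  HasEdge : Set
  HasEdge = ∃[ u ] ∃[ v ] Adj u v

module Submission where

-- A stepwise irregular graph G with an edge uv never has a stepwise irregular
-- subdivision S(G).  Let w be the vertex of S(G) subdividing uv.  Two facts
-- suffice:
--
--  * an original vertex keeps its degree in S(G): its neighbours there are
--    exactly the subdivision vertices of its incident edges;
--  * two naturals at distance 1 from a common third one are at distance 0
--    or 2, never 1.
--
-- If S(G) were stepwise irregular, d(u) and d(v) would both be at distance 1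
-- from d(w), hence not at distance 1 from each other, contradicting the
-- stepwise irregularity of G at the edge uv.

open import Defs
open import Data.Nat using (ℕ; zero; suc; _+_; _*_)
open import Data.Nat.Properties using (+-*-semiring; +-identityʳ)
import Data.Fin as Fin
open import Data.Fin using (Fin; _≟_) renaming (_<_ to _<ᶠ_)
open import Data.Fin.Properties using (_<?_; <-cmp; <-asym; <-irrefl; punchInᵢ≢i)
open import Data.List using (List; []; _∷_; _++_; map; concatMap; filter; length; tabulate; allFin)
open import Data.List.Properties using (length-++; filter-++; filter-none; concatMap-cong)
open import Data.List.Relation.Unary.All using (universal)
open import Data.Product using (Σ-syntax; _×_; _,_; proj₁; proj₂)
open import Data.Sum using (_⊎_; inj₁; inj₂)
import Data.Sum as Sum
open import Data.Empty using (⊥-elim)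
open import Function using (_∘_; id)
open import Relation.Binary using (tri<; tri≈; tri>)
open import Relation.Binary.PropositionalEquality using (_≡_; refl; sym; trans; cong; cong₂; subst; module ≡-Reasoning)
open import Relation.Nullary using (¬_; Dec; yes; no; contradiction)
open import Relation.Nullary.Decidable using (_×-dec_)
open import Algebra.Properties.Semiring.Sum +-*-semiring
  using (sum; sum-syntax; sum-cong-≗; sum-remove; sum-replicate-zero; ∑-distrib-+; *-distribˡ-sum)

dist≡1⇒consecutive : ∀ a b → dist a b ≡ 1 → a ≡ suc b ⊎ b ≡ suc a
dist≡1⇒consecutive zero          (suc zero)    _ = inj₂ refl
dist≡1⇒consecutive (suc zero)    zero          _ = inj₁ refl
dist≡1⇒consecutive (suc a)       (suc b)       d = Sum.map (cong suc) (cong suc) (dist≡1⇒consecutive a b d)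
dist≡1⇒consecutive zero          zero          ()
dist≡1⇒consecutive zero          (suc (suc b)) ()
dist≡1⇒consecutive (suc (suc a)) zero          ()

dist-self : ∀ a → dist a a ≡ 0
dist-self zero    = refl
dist-self (suc a) = dist-self a

dist-2+ˡ : ∀ a → dist (2 + a) a ≡ 2
dist-2+ˡ zero    = refl
dist-2+ˡ (suc a) = dist-2+ˡ a

dist-2+ʳ : ∀ a → dist a (2 + a) ≡ 2
dist-2+ʳ zero    = refl
dist-2+ʳ (suc a) = dist-2+ʳ a

common-neighbour : ∀ {a b c} → dist a c ≡ 1 → dist b c ≡ 1 → ¬ dist a b ≡ 1
common-neighbour {a} {b} {c} ac bc
  with dist≡1⇒consecutive a c ac | dist≡1⇒consecutive b c bc
... | inj₁ refl | inj₁ refl rewrite dist-self a  = λ ()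
... | inj₁ refl | inj₂ refl rewrite dist-2+ˡ b   = λ ()
... | inj₂ refl | inj₁ refl rewrite dist-2+ʳ a   = λ ()
... | inj₂ refl | inj₂ refl rewrite dist-self a  = λ ()

count : ∀ {a p} {A : Set a} {P : A → Set p} → (∀ x → Dec (P x)) → List A → ℕ
count P? xs = length (filter P? xs)

𝟙 : ∀ {p} {P : Set p} → Dec P → ℕ
𝟙 (yes _) = 1
𝟙 (no _)  = 0

𝟙-yes : ∀ {p} {P : Set p} → P → (d : Dec P) → 𝟙 d ≡ 1
𝟙-yes _ (yes _)  = refl
𝟙-yes p (no ¬p)  = contradiction p ¬p

𝟙-no : ∀ {p} {P : Set p} → ¬ P → (d : Dec P) → 𝟙 d ≡ 0
𝟙-no ¬p (yes p) = contradiction p ¬p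
𝟙-no _  (no _)  = refl

𝟙-exclusive-or : ∀ {p q r} {P : Set p} {Q : Set q} {R : Set r} (p? : Dec P) (q? : Dec Q) (r? : Dec R) →
                 ¬ (P × Q) → (R → P ⊎ Q) → (P → R) → (Q → R) → 𝟙 p? + 𝟙 q? ≡ 𝟙 r?
𝟙-exclusive-or (yes p) (yes q) _       excl _     _   _   = contradiction (p , q) excl
𝟙-exclusive-or (yes p) (no _)  r?      _    _     P→R _   = sym (𝟙-yes (P→R p) r?)
𝟙-exclusive-or (no _)  (yes q) r?      _    _     _   Q→R = sym (𝟙-yes (Q→R q) r?)
𝟙-exclusive-or (no ¬p) (no ¬q) (yes r) _    R→P⊎Q _   _   = contradiction (R→P⊎Q r) (Sum.[ ¬p , ¬q ])
𝟙-exclusive-or (no _)  (no _)  (no _)  _    _     _   _   = refl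

module _ {a p} {A : Set a} {P : A → Set p} (P? : ∀ x → Dec (P x)) where

  count-∷ : ∀ x xs → count P? (x ∷ xs) ≡ 𝟙 (P? x) + count P? xs
  count-∷ x xs with P? x
  ... | yes _ = refl
  ... | no _  = refl

  count-++ : ∀ xs ys → count P? (xs ++ ys) ≡ count P? xs + count P? ys
  count-++ xs ys = trans (cong length (filter-++ P? xs ys)) (length-++ (filter P? xs))

  count-none : (∀ x → ¬ P x) → ∀ xs → count P? xs ≡ 0
  count-none ¬P xs = cong length (filter-none P? (universal ¬P xs))

  count-map : ∀ {b} {B : Set b} (f : B → A) xs → count P? (map f xs) ≡ count (P? ∘ f) xs
  count-map f []       = refl
  count-map f (x ∷ xs) with P? (f x)
  ... | yes _ = cong suc (count-map f xs)
  ... | no _  = count-map f xs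

  count-tabulate : ∀ {n} (g : Fin n → A) → count P? (tabulate g) ≡ ∑[ i < n ] 𝟙 (P? (g i))
  count-tabulate {zero}  g = refl
  count-tabulate {suc n} g = trans (count-∷ (g Fin.zero) _) (cong (𝟙 (P? (g Fin.zero)) +_) (count-tabulate (g ∘ Fin.suc)))

  count-concatMap : ∀ {b n} {B : Set b} (f : B → List A) (g : Fin n → B) →
                    count P? (concatMap f (tabulate g)) ≡ ∑[ i < n ] count P? (f (g i))
  count-concatMap {n = zero}  f g = refl
  count-concatMap {n = suc n} f g =
    trans (count-++ (f (g Fin.zero)) _) (cong (count P? (f (g Fin.zero)) +_) (count-concatMap f (g ∘ Fin.suc)))

sum-δ : ∀ {n} (u : Fin n) (f : Fin n → ℕ) → ∑[ i < n ] (𝟙 (i ≟ u) * f i) ≡ f u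
sum-δ {suc n} u f = begin
  ∑[ i < suc n ] (𝟙 (i ≟ u) * f i)                  ≡⟨ sum-remove {i = u} (λ i → 𝟙 (i ≟ u) * f i) ⟩
  𝟙 (u ≟ u) * f u + ∑[ k < n ] δ-off-diagonal k     ≡⟨ cong₂ (λ c s → c * f u + s) (𝟙-yes refl (u ≟ u)) zero-sum ⟩
  f u + 0 + 0                                       ≡⟨ trans (+-identityʳ _) (+-identityʳ _) ⟩
  f u                                               ∎
  where
  open ≡-Reasoning
  δ-off-diagonal : Fin n → ℕ
  δ-off-diagonal k = 𝟙 (Fin.punchIn u k ≟ u) * f (Fin.punchIn u k)
  zero-sum : ∑[ k < n ] δ-off-diagonal k ≡ 0
  zero-sum = trans (sum-cong-≗ (λ k → cong (_* f (Fin.punchIn u k)) (𝟙-no (punchInᵢ≢i u k) (Fin.punchIn u k ≟ u))))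
                   (sum-replicate-zero n)

module _ {n : ℕ} (G : SimpleGraph n) where
  open SimpleGraph G renaming (sym to Adj-sym)

  Oriented? : (i j : Fin n) → Dec (i <ᶠ j × Adj i j)
  Oriented? i j = (i <? j) ×-dec adj? i j

  edgeIf : (i j : Fin n) → Dec (i <ᶠ j × Adj i j) → List (Edge G)
  edgeIf i j (yes p) = (i , j , p) ∷ []
  edgeIf i j (no _)  = []

  -- edgeList contributes the pairs through a local helper that is not in
  -- scope; this names it as the row function of edgeList's unfolding.
  edgeList-rows : Σ[ row ∈ (Fin n → Fin n → List (Edge G)) ]
                  edgeList G ≡ concatMap (λ i → concatMap (row i) (allFin n)) (allFin n)
  edgeList-rows = _ , refl

  -- The hidden helper agrees with edgeIf: both branch on the same decision.
  row≗edgeIf : ∀ i j → proj₁ edgeList-rows i j ≡ edgeIf i j (Oriented? i j)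
  row≗edgeIf i j with Oriented? i j
  ... | yes _ = refl
  ... | no _  = refl

  edgeList≡ : edgeList G ≡ concatMap (λ i → concatMap (λ j → edgeIf i j (Oriented? i j)) (allFin n)) (allFin n)
  edgeList≡ = trans (proj₂ edgeList-rows)
                    (concatMap-cong (λ i → concatMap-cong (row≗edgeIf i) (allFin n)) (allFin n))

  incidences : ∀ u i j → count (inc? G u) (edgeIf i j (Oriented? i j)) ≡
               𝟙 (i ≟ u) * 𝟙 (Oriented? u j) + 𝟙 (j ≟ u) * 𝟙 (Oriented? i u)
  incidences u i j with i ≟ u | j ≟ u
  ... | yes refl | yes refl with Oriented? i i
  ...   | yes (i<i , _) = ⊥-elim (<-irrefl refl i<i)
  ...   | no _          = refl
  incidences u i j | yes refl | no j≢u with Oriented? i j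
  ...   | yes p = trans (count-∷ (inc? G i) (i , j , p) []) (cong (_+ 0) (𝟙-yes (inj₁ refl) _))
  ...   | no _  = refl
  incidences u i j | no i≢u | yes refl with Oriented? i j
  ...   | yes p = trans (count-∷ (inc? G j) (i , j , p) []) (cong (_+ 0) (𝟙-yes (inj₂ refl) _))
  ...   | no _  = refl
  incidences u i j | no i≢u | no j≢u with Oriented? i j
  ...   | yes p = trans (count-∷ (inc? G u) (i , j , p) []) (cong (_+ 0) (𝟙-no endpoint _))
    where
    endpoint : ¬ (u ≡ i ⊎ u ≡ j)
    endpoint (inj₁ u≡i) = i≢u (sym u≡i)
    endpoint (inj₂ u≡j) = j≢u (sym u≡j)
  ...   | no _  = refl

  one-orientation : ∀ u j → 𝟙 (Oriented? u j) + 𝟙 (Oriented? j u) ≡ 𝟙 (adj? u j)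
  one-orientation u j =
    𝟙-exclusive-or (Oriented? u j) (Oriented? j u) (adj? u j)
      (λ ((u<j , _) , (j<u , _)) → <-asym u<j j<u) orient proj₂ (Adj-sym ∘ proj₂)
    where
    orient : Adj u j → (u <ᶠ j × Adj u j) ⊎ (j <ᶠ u × Adj j u)
    orient a with <-cmp u j
    ... | tri< u<j _ _  = inj₁ (u<j , a)
    ... | tri≈ _ refl _ = ⊥-elim (irr refl a)
    ... | tri> _ _ j<u  = inj₂ (j<u , Adj-sym a)

  incident-edges : ∀ u → count (inc? G u) (edgeList G) ≡ FinGraph.degree (toFinGraph G) u
  incident-edges u = begin
    count (inc? G u) (edgeList G)
      ≡⟨ cong (count (inc? G u)) edgeList≡ ⟩
    count (inc? G u) (concatMap (λ i → concatMap (λ j → edgeIf i j (Oriented? i j)) (allFin n)) (allFin n))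
      ≡⟨ count-concatMap (inc? G u) (λ i → concatMap (λ j → edgeIf i j (Oriented? i j)) (allFin n)) id ⟩
    ∑[ i < n ] count (inc? G u) (concatMap (λ j → edgeIf i j (Oriented? i j)) (allFin n))
      ≡⟨ sum-cong-≗ (λ i → count-concatMap (inc? G u) (λ j → edgeIf i j (Oriented? i j)) id) ⟩
    ∑[ i < n ] ∑[ j < n ] count (inc? G u) (edgeIf i j (Oriented? i j))
      ≡⟨ sum-cong-≗ (λ i → sum-cong-≗ (incidences u i)) ⟩
    ∑[ i < n ] ∑[ j < n ] (𝟙 (i ≟ u) * out j + 𝟙 (j ≟ u) * into i)
      ≡⟨ sum-cong-≗ (λ i → ∑-distrib-+ (λ j → 𝟙 (i ≟ u) * out j) (λ j → 𝟙 (j ≟ u) * into i)) ⟩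
    ∑[ i < n ] (∑[ j < n ] (𝟙 (i ≟ u) * out j) + ∑[ j < n ] (𝟙 (j ≟ u) * into i))
      ≡⟨ sum-cong-≗ (λ i → cong₂ _+_ (sym (*-distribˡ-sum (𝟙 (i ≟ u)) out)) (sum-δ u (λ _ → into i))) ⟩
    ∑[ i < n ] (𝟙 (i ≟ u) * sum out + into i)
      ≡⟨ ∑-distrib-+ (λ i → 𝟙 (i ≟ u) * sum out) into ⟩
    ∑[ i < n ] (𝟙 (i ≟ u) * sum out) + sum into
      ≡⟨ cong (_+ sum into) (sum-δ u (λ _ → sum out)) ⟩
    sum out + sum into
      ≡⟨ sym (∑-distrib-+ out into) ⟩
    ∑[ j < n ] (out j + into j)
      ≡⟨ sum-cong-≗ (one-orientation u) ⟩
    ∑[ j < n ] 𝟙 (adj? u j)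
      ≡⟨ sym (count-tabulate (adj? u) id) ⟩
    count (adj? u) (allFin n) ∎
    where
    open ≡-Reasoning
    out into : Fin n → ℕ
    out  j = 𝟙 (Oriented? u j)
    into i = 𝟙 (Oriented? i u)

  -- In S(G) the neighbours of an original vertex are the subdivision
  -- vertices of its incident edges, so its degree is unchanged.
  degree-preserved : ∀ u → FinGraph.degree (subdivision G) (inj₁ u) ≡ FinGraph.degree (toFinGraph G) u
  degree-preserved u = begin
    count (sadj? G (inj₁ u)) (map inj₁ (allFin n) ++ map inj₂ (edgeList G))
      ≡⟨ count-++ (sadj? G (inj₁ u)) (map inj₁ (allFin n)) _ ⟩
    count (sadj? G (inj₁ u)) (map inj₁ (allFin n)) + count (sadj? G (inj₁ u)) (map inj₂ (edgeList G))
      ≡⟨ cong₂ _+_ (trans (count-map (sadj? G (inj₁ u)) inj₁ (allFin n)) (count-none _ (λ _ ()) (allFin n)))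
                   (count-map (sadj? G (inj₁ u)) inj₂ (edgeList G)) ⟩
    count (inc? G u) (edgeList G)
      ≡⟨ incident-edges u ⟩
    FinGraph.degree (toFinGraph G) u ∎
    where open ≡-Reasoning

  subdividing-vertex : ∀ {u v} → Adj u v → Σ[ e ∈ Edge G ] Inc G u e × Inc G v e
  subdividing-vertex {u} {v} a with <-cmp u v
  ... | tri< u<v _ _  = (u , v , u<v , a) , inj₁ refl , inj₂ refl
  ... | tri≈ _ refl _ = ⊥-elim (irr refl a)
  ... | tri> _ _ v<u  = (v , u , v<u , Adj-sym a) , inj₂ refl , inj₁ refl

  endpoint-step : StepwiseIrregular (subdivision G) → ∀ x e → Inc G x e →
                  dist (FinGraph.degree (toFinGraph G) x) (FinGraph.degree (subdivision G) (inj₂ e)) ≡ 1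
  endpoint-step siS x e x∈e = subst (λ d → dist d _ ≡ 1) (degree-preserved x) (siS (inj₁ x) (inj₂ e) x∈e)

mainTheorem15 : {n : ℕ} (G : SimpleGraph n) → Connected G → HasEdge G →
                StepwiseIrregular (toFinGraph G) →
                ¬ StepwiseIrregular (subdivision G)
mainTheorem15 {n} G _ (u , v , u~v) siG siS with subdividing-vertex G u~v
... | e , u∈e , v∈e =
  common-neighbour {degree-G u} {degree-G v} {degree-S (inj₂ e)}
    (endpoint-step G siS u e u∈e) (endpoint-step G siS v e v∈e) (siG u v u~v)
  where
  degree-G : Fin n → ℕ
  degree-G = FinGraph.degree (toFinGraph G)
  degree-S : FinGraph.V (subdivision G) → ℕ
  degree-S = FinGraph.degree (subdivision G)
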